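{- For $n\ge 2$, the number of $\pi\in S_n$ avoiding both arrow patterns $(12;2\to 3)$ and $(1;1\to 1)$ equals the Gould number $G_{n-2}$.
   Context: Standard cycle form of $\sigma\in S_n$: product of disjoint cycles (fixed points included), each cycle starting with its largest element, cycles listed in increasing order of largest elements. The fundamental bijection $\theta:S_n\to S_n$ erases the parentheses of the standard cycle form to give a one-line permutation. For $\pi\in S_n$, $\hat\pi=\theta^{ -1}(\pi)$. An arrow pattern $(\nu;H)$ of size $k$: a string $\nu=a_1\dots a_m$ of positive integers and a set $H$ of arrows $b\to c$, with all integers appearing forming $[k]$. $\pi\in S_n$ contains $(\nu;H)$ if there is $X=\{x_1<\dots<x_k\}\subseteq[n]$ with positions $t_1<\dots<t_m$ such that $\pi_{t_1}\cdots\pi_{t_m}=x_{a_1}\cdots x_{a_m}$ and $\hat\pi(x_b)=x_c$ for every arrow $b\to c\in H$; otherwise it avoids it. In particular $\pi$ avoids $(1;1\to1)$ iff $\hat\pi$ has no fixed points. The Gould numbers (OEIS A040027: $1,1,3,9,31,121,\dots$) are defined by $G_0=1$ and $G_m=\sum_{k=1}^{m}\binom{m}{k}G_{k-1}$ for $m\ge1$. -}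

module Defs where

open import Data.Nat using (ℕ; zero; suc; _≤_; _<_; _≡ᵇ_; _≤ᵇ_)
open import Data.Bool using (Bool; if_then_else_)
open import Data.List using (List; []; _∷_; length; applyUpTo; concatMap; filterᵇ; map)
open import Data.Bool.ListAction using (and)
open import Data.List.Membership.Propositional using (_∈_)
open import Data.List.Relation.Binary.Permutation.Propositional using (_↭_)
open import Data.Product using (Σ; _×_; _,_)
open import Relation.Binary.PropositionalEquality using (_≡_)
open import Relation.Nullary using (¬_)

[1‥_] : ℕ → List ℕ
[1‥ n ] = applyUpTo suc n

-- 1-based lookup in a word (0 if out of range)
nth : List ℕ → ℕ → ℕ
nth []       _             = 0
nth (x ∷ xs) zero          = 0
nth (x ∷ xs) (suc zero)    = x
nth (x ∷ xs) (suc (suc i)) = nth xs (suc i)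

-- A permutation of [n], in one-line notation π₁ … πₙ (so π(i) = nth π i).
IsPerm : ℕ → List ℕ → Set
IsPerm n π = π ↭ [1‥ n ]

orbitTail : ℕ → List ℕ → ℕ → ℕ → List ℕ
orbitTail zero    σ m y = []
orbitTail (suc f) σ m y = if y ≡ᵇ m then [] else (y ∷ orbitTail f σ m (nth σ y))

cycleFrom : List ℕ → ℕ → List ℕ
cycleFrom σ m = m ∷ orbitTail (length σ) σ m (nth σ m)

isCycleMax : List ℕ → ℕ → Bool
isCycleMax σ m = and (map (λ y → y ≤ᵇ m) (cycleFrom σ m))

-- standard cycle form: cycles each starting with their largest element,
-- listed in increasing order of largest elements
standardCycleForm : List ℕ → List (List ℕ)
standardCycleForm σ = map (cycleFrom σ) (filterᵇ (isCycleMax σ) [1‥ length σ ])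

θ : List ℕ → List ℕ
θ σ = Data.List.concat (standardCycleForm σ)

-- π̂ = θ⁻¹(π):  Hat n π x y  means  π̂(x) = y
Hat : ℕ → List ℕ → ℕ → ℕ → Set
Hat n π x y = Σ (List ℕ) λ σ → IsPerm n σ × θ σ ≡ π × nth σ x ≡ y

-- Arrow pattern (ν ; H) of size k; letters and arrow endpoints are in [k] (1-based)
record ArrowPattern : Set where
  constructor ⟨_∣_∣_⟩
  field
    size   : ℕ
    word   : List ℕ
    arrows : List (ℕ × ℕ)

open ArrowPattern public

-- π ∈ S_n contains (ν;H): there are X = {x₁<…<x_k} ⊆ [n] (x : ℕ → ℕ, used on 1..k)
-- and positions t₁<…<t_m (t : ℕ → ℕ, used on 1..m) in [n] with
-- π_{t_j} = x_{a_j} and π̂(x_b) = x_c for all b→c ∈ H.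
Contains : ℕ → List ℕ → ArrowPattern → Set
Contains n π p =
  Σ (ℕ → ℕ) λ x → Σ (ℕ → ℕ) λ t →
    (∀ i → 1 ≤ i → i ≤ size p → 1 ≤ x i × x i ≤ n)
  × (∀ i → 1 ≤ i → i < size p → x i < x (suc i))
  × (∀ j → 1 ≤ j → j ≤ length (word p) → 1 ≤ t j × t j ≤ n)
  × (∀ j → 1 ≤ j → j < length (word p) → t j < t (suc j))
  × (∀ j → 1 ≤ j → j ≤ length (word p) → nth π (t j) ≡ x (nth (word p) j))
  × (∀ b c → (b , c) ∈ arrows p → Hat n π (x b) (x c))

Avoids : ℕ → List ℕ → ArrowPattern → Set
Avoids n π p = ¬ Contains n π p

pat-12-2→3 : ArrowPattern
pat-12-2→3 = ⟨ 3 ∣ 1 ∷ 2 ∷ [] ∣ (2 , 3) ∷ [] ⟩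

pat-1-1→1 : ArrowPattern
pat-1-1→1 = ⟨ 1 ∣ 1 ∷ [] ∣ (1 , 1) ∷ [] ⟩

module Submission where

-- Write π = θ(σ). Reading π from left to right, σ sends each entry to the next one, unless the
-- next one is a new left-to-right maximum; then the current cycle closes and the entry is sent
-- to its head, the current maximum. Consequently σ has no fixed point and no occurrence of
-- (12;2→3) iff π₂ < π₁, every later entry that is not a new left-to-right minimum is immediately
-- followed by a smaller one, and the last entry is a new minimum, i.e. π = α 1. In such an
-- "admissible" word α on a set W, the entries after min W decrease and those before it form an
-- admissible word again. Choosing which of the other m letters follow min W shows that the number
-- a(k) of admissible words on k letters satisfies a(0) = 0, a(1) = 1 and
-- a(m+1) = Σⱼ C(m,j) a(j): Gould's recurrence for a(k+1) = G_k. The avoiders in S_n are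
-- counted by a(n-1) = G_{n-2}.

open import Defs
open import Algebra.Properties.CommutativeSemigroup using (interchange)
open import Data.Bool.Base using (true; false)
import Data.Bool.Base as Bool
open import Data.Bool.ListAction using (all)
open import Data.Empty using (⊥)
open import Data.List.Base
  using (List; []; _∷_; [_]; _++_; _∷ʳ_; length; map; concat; concatMap; applyUpTo; filter; filterᵇ;
         reverse; take; drop; initLast; _∷ʳ′_)
open import Data.List.Properties
  using (length-++; length-map; length-applyUpTo; length-++-≤ˡ; length-++-≤ʳ; length-++-sucʳ;
         ++-identityʳ; ++-assoc; ++-cancelʳ;
         map-++; map-∘; map-cong-local; ∷-injective; ∷-injectiveˡ; ∷-injectiveʳ; ∷ʳ-injectiveˡ;
         reverse-involutive; reverse-injective; unfold-reverse)
open import Data.List.Membership.Propositional using (_∈_; _∉_)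
open import Data.List.Membership.Propositional.Properties
  using (∈-applyUpTo⁻; ∈-filter⁺; ∈-filter⁻; ∈-∃++; ∈-map⁺; ∈-map⁻; ∈-concat⁺′; ∈-concat⁻′; ∈-++⁺ˡ;
         ∈-++⁺ʳ; ∈-++⁻)
open import Data.List.Relation.Unary.Any using (here; there)
open import Data.List.Relation.Unary.All using (All; []; _∷_)
  renaming (lookup to All-lookup; map to All-map; tabulate to All-tabulate)
open import Data.List.Relation.Unary.All.Properties
  using (all⁺; all⁻; ++⁻ˡ; ++⁻ʳ) renaming (++⁺ to All-++⁺)
open import Data.List.Relation.Unary.AllPairs using (AllPairs; []; _∷_)
import Data.List.Relation.Unary.AllPairs as AllPairs
import Data.List.Relation.Unary.AllPairs.Properties as AllPairsₚ
open import Data.List.Relation.Unary.Linked using (Linked; []; [-]; _∷_)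
open import Data.List.Relation.Unary.Linked.Properties using (AllPairs⇒Linked; Linked⇒AllPairs)
open import Data.List.Relation.Unary.Unique.Propositional using (Unique)
open import Data.List.Relation.Unary.Unique.Propositional.Properties
  using (Unique[x∷xs]⇒x∉xs) renaming (map⁺ to Unique-map⁺; ++⁺ to Unique-++⁺)
open import Data.List.Relation.Binary.Permutation.Propositional
  using (_↭_; prep; swap; ↭-refl; ↭-sym; ↭-trans; ↭⇒↭ₛ; module PermutationReasoning)
open import Data.List.Relation.Binary.Permutation.Propositional.Properties
  using (∈-resp-↭; All-resp-↭; ↭-length; map⁺; ++⁺; drop-∷; shift; ∷↭∷ʳ; ↭-reverse; ++-comm;
         ↭-empty-inv; ↭-singleton-inv)
import Data.List.Relation.Binary.Permutation.Setoid.Properties as PermutationSetoid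
open import Data.List.Relation.Ternary.Interleaving.Propositional
  using (Interleaving; toPermutation; consˡ; consʳ; [])
open import Data.Nat.Base
  using (ℕ; zero; suc; _+_; _*_; _∸_; _≤_; _<_; _>_; _⊔_; _⊓_; _≡ᵇ_; _≤ᵇ_; z≤n; s≤s)
open import Data.Nat.Combinatorics using (_C_; nCk+nC[k+1]≡[n+1]C[k+1]; k>n⇒nCk≡0)
open import Data.Nat.ListAction using (sum)
open import Data.Nat.ListAction.Properties using (sum-++)
open import Data.Nat.Properties
  using (_≟_; _≤?_; _<?_; <-cmp; ≤-pred; ≤-refl; ≤-reflexive; ≤-trans; ≤-antisym; <-trans; <-irrefl;
         <-asym; <-≤-trans; ≤-<-trans;
         <⇒≤; <⇒≢; <⇒≱; ≮⇒≥; ≰⇒>; ≤∧≢⇒<; n≤1+n; n<1+n; m≤m+n; m≤n+m; ≤ᵇ⇒≤; ≤⇒≤ᵇ; ≡ᵇ⇒≡; ≡⇒≡ᵇ;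
         m≤m⊔n; m≤n⊔m; m≥n⇒m⊔n≡m; m≤n⇒m⊔n≡n; m⊓n≤m; m⊓n≤n; ⊓-sel; ⊓-pres-m<; m<n⊓o⇒m<n; m<n⊓o⇒m<o;
         +-identityʳ; +-assoc; +-comm; *-distribʳ-+; +-commutativeSemigroup)
open import Data.List.Membership.DecPropositional _≟_ using (_∈?_)
open import Data.Product using (Σ; _×_; _,_; proj₁; proj₂; map₁; map₂)
open import Data.Sum using (_⊎_; inj₁; inj₂)
open import Data.Unit using (⊤; tt)
open import Function.Base using (_∘_; flip)
open import Function.Bundles using (_⇔_; mk⇔; Equivalence)
import Function.Properties.Equivalence as ⇔
open import Relation.Binary.Definitions using (tri<; tri≈; tri>)
open import Relation.Binary.PropositionalEquality
  using (_≡_; _≢_; refl; sym; trans; cong; cong₂; subst; setoid; module ≡-Reasoning)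
open import Relation.Nullary using (¬_; ¬?; contradiction; yes; no)
open import Relation.Nullary.Decidable using (T?)
open import Relation.Unary using (Decidable)


[1‥]-increasing : ∀ n → AllPairs _<_ [1‥ n ]
[1‥]-increasing n = AllPairsₚ.applyUpTo⁺₁ suc n (λ i<j _ → s≤s i<j)

∈-[1‥]⁻ : ∀ n {x} → x ∈ [1‥ n ] → 1 ≤ x × x ≤ n
∈-[1‥]⁻ n x∈ with ∈-applyUpTo⁻ suc x∈
... | _ , i<n , refl = s≤s z≤n , i<n

IsPerm-length : ∀ {n σ} → IsPerm n σ → length σ ≡ n
IsPerm-length {n} p = trans (↭-length p) (length-applyUpTo suc n)

increasing⇒unique : ∀ {xs} → AllPairs _<_ xs → Unique xs
increasing⇒unique = AllPairs.map (λ lt eq → <-irrefl eq lt)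

[1‥]-unique : ∀ n → Unique [1‥ n ]
[1‥]-unique n = increasing⇒unique ([1‥]-increasing n)

Unique-resp-↭ : ∀ {xs ys : List ℕ} → xs ↭ ys → Unique xs → Unique ys
Unique-resp-↭ p = PermutationSetoid.Unique-resp-↭ (setoid ℕ) (↭⇒↭ₛ p)

Unique-++⁻ : ∀ xs {ys : List ℕ} → Unique (xs ++ ys) → Unique xs × Unique ys
Unique-++⁻ []       u          = [] , u
Unique-++⁻ (x ∷ xs) (x∉ ∷ u) = (++⁻ˡ xs x∉ ∷ proj₁ (Unique-++⁻ xs u)) , proj₂ (Unique-++⁻ xs u)

Unique-++⇒disjoint : ∀ xs {ys : List ℕ} {x} → Unique (xs ++ ys) → x ∈ xs → x ∉ ys
Unique-++⇒disjoint (_ ∷ xs) (x∉ ∷ _) (here refl) x∈ys = All-lookup (++⁻ʳ xs x∉) x∈ys refl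
Unique-++⇒disjoint (_ ∷ xs) (_ ∷ un) (there x∈xs) x∈ys = Unique-++⇒disjoint xs un x∈xs x∈ys

increasing-ext : ∀ {xs ys} → AllPairs _<_ xs → AllPairs _<_ ys →
    (∀ {z} → z ∈ xs → z ∈ ys) → (∀ {z} → z ∈ ys → z ∈ xs) → xs ≡ ys
increasing-ext {[]} {[]} _ _ _ _ = refl
increasing-ext {[]} {y ∷ ys} _ _ _ ys⊆ with ys⊆ (here refl)
... | ()
increasing-ext {x ∷ xs} {[]} _ _ xs⊆ _ with xs⊆ (here refl)
... | ()
increasing-ext {x ∷ xs} {y ∷ ys} (x< ∷ xs↑) (y< ∷ ys↑) xs⊆ ys⊆ with xs⊆ (here refl) | ys⊆ (here refl)
... | here refl | _ = cong (x ∷_) (increasing-ext xs↑ ys↑ (drop-head x< xs⊆) (drop-head y< ys⊆))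
  where
  drop-head : ∀ {u us vs} → All (u <_) us → (∀ {z} → z ∈ u ∷ us → z ∈ u ∷ vs) → ∀ {z} → z ∈ us → z ∈ vs
  drop-head u< ⊆ z∈ with ⊆ (there z∈)
  ... | here refl = contradiction (All-lookup u< z∈) (<-irrefl refl)
  ... | there z∈′ = z∈′
... | there x∈ys | here refl = contradiction (All-lookup y< x∈ys) (<-irrefl refl)
... | there x∈ys | there y∈xs = contradiction (All-lookup y< x∈ys) (<-asym (All-lookup x< y∈xs))

AllPairs-reverse : ∀ {R : ℕ → ℕ → Set} {xs} → AllPairs R xs → AllPairs (flip R) (reverse xs)
AllPairs-reverse {xs = []}     []         = []
AllPairs-reverse {xs = x ∷ xs} (x~ ∷ xs~) = subst (AllPairs _) (sym (unfold-reverse x xs))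
  (AllPairsₚ.++⁺ (AllPairs-reverse xs~) ([] ∷ []) (All-map (_∷ []) (All-resp-↭ (↭-sym (↭-reverse xs)) x~)))

Interleaving-AllPairs : ∀ {R : ℕ → ℕ → Set} {T S xs} → Interleaving T S xs → AllPairs R xs →
    AllPairs R T × AllPairs R S
Interleaving-AllPairs []        [] = [] , []
Interleaving-AllPairs (consˡ i) (x~ ∷ xs~) with Interleaving-AllPairs i xs~
... | T~ , S~ = (++⁻ˡ _ (All-resp-↭ (toPermutation i) x~) ∷ T~) , S~
Interleaving-AllPairs (consʳ i) (x~ ∷ xs~) with Interleaving-AllPairs i xs~
... | T~ , S~ = T~ , (++⁻ʳ _ (All-resp-↭ (toPermutation i) x~) ∷ S~)

filter-∈-decreasing : ∀ {xs γ} → AllPairs _<_ xs → Linked _>_ γ → (∀ {y} → y ∈ γ → y ∈ xs) →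
    filter (_∈? γ) xs ≡ reverse γ
filter-∈-decreasing {xs} {γ} xs↑ γ↓ γ⊆ = increasing-ext (AllPairsₚ.filter⁺ (_∈? γ) xs↑)
  (AllPairs-reverse (Linked⇒AllPairs (λ z<y y<x → <-trans y<x z<y) γ↓))
  (λ y∈ → ∈-resp-↭ (↭-sym (↭-reverse γ)) (proj₂ (∈-filter⁻ (_∈? γ) {xs = xs} y∈)))
  (λ y∈ → let y∈γ = ∈-resp-↭ (↭-reverse γ) y∈ in ∈-filter⁺ (_∈? γ) (γ⊆ y∈γ) y∈γ)

++-cancelˡ-↭ : ∀ γ {β S : List ℕ} → γ ++ β ↭ γ ++ S → β ↭ S
++-cancelˡ-↭ []      p = p
++-cancelˡ-↭ (c ∷ γ) p = ++-cancelˡ-↭ γ (drop-∷ p)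

++-∷-injective : ∀ {w} β β′ {γ γ′ : List ℕ} → w ∉ β → w ∉ β′ → β ++ w ∷ γ ≡ β′ ++ w ∷ γ′ → β ≡ β′ × γ ≡ γ′
++-∷-injective []      []       _  _   refl = refl , refl
++-∷-injective []      (b ∷ β′) _  w∉′ eq   = contradiction (here (∷-injectiveˡ eq)) w∉′
++-∷-injective (b ∷ β) []       w∉ _   eq   = contradiction (here (sym (∷-injectiveˡ eq))) w∉
++-∷-injective (b ∷ β) (c ∷ β′) w∉ w∉′ eq with ∷-injective eq
... | refl , eq′ = map₁ (cong (b ∷_)) (++-∷-injective β β′ (w∉ ∘ there) (w∉′ ∘ there) eq′)

∈-concatMap⁻ : ∀ {A B : Set} (g : A → List B) xs {v} → v ∈ concatMap g xs → Σ A λ a → a ∈ xs × v ∈ g a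
∈-concatMap⁻ g (a ∷ xs) v∈ with ∈-++⁻ (g a) v∈
... | inj₁ v∈ga   = a , here refl , v∈ga
... | inj₂ v∈rest = let b , b∈ , v∈gb = ∈-concatMap⁻ g xs v∈rest in b , there b∈ , v∈gb

∈-concatMap⁺ : ∀ {A B : Set} (g : A → List B) {xs a v} → a ∈ xs → v ∈ g a → v ∈ concatMap g xs
∈-concatMap⁺ g a∈ v∈ = ∈-concat⁺′ v∈ (∈-map⁺ g a∈)

Unique-concatMap : ∀ {A B K : Set} (g : A → List B) (k : A → K) xs → Unique (map k xs) →
    (∀ {a} → a ∈ xs → Unique (g a)) →
    (∀ {a b v} → a ∈ xs → b ∈ xs → v ∈ g a → v ∈ g b → k a ≡ k b) → Unique (concatMap g xs)
Unique-concatMap g k []       _          _  _    = []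
Unique-concatMap g k (a ∷ xs) (ka∉ ∷ uk) ug same =
  Unique-++⁺ (ug (here refl)) (Unique-concatMap g k xs uk (ug ∘ there) (λ a∈ b∈ → same (there a∈) (there b∈))) disjoint
  where
  disjoint : ∀ {v} → ¬ (v ∈ g a × v ∈ concatMap g xs)
  disjoint (v∈ga , v∈rest) with ∈-concatMap⁻ g xs v∈rest
  ... | b , b∈ , v∈gb = All-lookup ka∉ (∈-map⁺ k b∈) (same (here refl) (there b∈) v∈ga v∈gb)

length-concatMap : ∀ {A B : Set} (g : A → List B) xs → length (concatMap g xs) ≡ sum (map (length ∘ g) xs)
length-concatMap g []       = refl
length-concatMap g (a ∷ xs) = trans (length-++ (g a)) (cong (length (g a) +_) (length-concatMap g xs))

nth-∈ : ∀ l i → i < length l → nth l (suc i) ∈ l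
nth-∈ (x ∷ xs) zero    _         = here refl
nth-∈ (x ∷ xs) (suc i) (s≤s i<n) = there (nth-∈ xs i i<n)

∈⇒nth : ∀ {y} l → y ∈ l → Σ ℕ λ i → i < length l × nth l (suc i) ≡ y
∈⇒nth (x ∷ xs) (here refl) = zero , s≤s z≤n , refl
∈⇒nth (x ∷ xs) (there y∈) with ∈⇒nth xs y∈
... | i , i<n , eq = suc i , s≤s i<n , eq

nth-++ˡ : ∀ u w i → i < length u → nth (u ++ w) (suc i) ≡ nth u (suc i)
nth-++ˡ (x ∷ u) w zero    _         = refl
nth-++ˡ (x ∷ u) w (suc i) (s≤s i<n) = nth-++ˡ u w i i<n

nth-++-∷ : ∀ u a v → nth (u ++ a ∷ v) (suc (length u)) ≡ a
nth-++-∷ []      a v = refl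
nth-++-∷ (x ∷ u) a v = nth-++-∷ u a v

split-at-nth : ∀ l j → j < length l → l ≡ take j l ++ nth l (suc j) ∷ drop (suc j) l
split-at-nth (x ∷ xs) zero    _         = refl
split-at-nth (x ∷ xs) (suc j) (s≤s j<n) = cong (x ∷_) (split-at-nth xs j j<n)

nth-∈-take : ∀ l i j → i < j → j ≤ length l → nth l (suc i) ∈ take j l
nth-∈-take (x ∷ xs) zero    (suc j) _         _         = here refl
nth-∈-take (x ∷ xs) (suc i) (suc j) (s≤s i<j) (s≤s j≤n) = there (nth-∈-take xs i j i<j j≤n)

nth-map-applyUpTo : ∀ (f g : ℕ → ℕ) n i → i < n → nth (map f (applyUpTo g n)) (suc i) ≡ f (g i)
nth-map-applyUpTo f g (suc n) zero    _        = refl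
nth-map-applyUpTo f g (suc n) (suc i) (s≤s i<n) = nth-map-applyUpTo f (g ∘ suc) n i i<n


-- Cycles and the word θ σ

Chain : (ℕ → ℕ) → ℕ → List ℕ → Set
Chain s h []          = ⊤
Chain s h (x ∷ [])    = s x ≡ h
Chain s h (x ∷ y ∷ r) = s x ≡ y × Chain s h (y ∷ r)

IsCycle : (ℕ → ℕ) → List ℕ → Set
IsCycle s []      = ⊥
IsCycle s (h ∷ t) = Chain s h (h ∷ t)

Chain-suffix : ∀ {s h} us {x vs} → Chain s h (us ++ x ∷ vs) → Chain s h (x ∷ vs)
Chain-suffix []           c       = c
Chain-suffix (_ ∷ [])     (_ , c) = c
Chain-suffix (_ ∷ u ∷ us) (_ , c) = Chain-suffix (u ∷ us) c

≡ᵇ-true⇒≡ : ∀ {m n} → (m ≡ᵇ n) ≡ true → m ≡ n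
≡ᵇ-true⇒≡ {m} {n} eq = ≡ᵇ⇒≡ m n (subst Bool.T (sym eq) tt)

≡ᵇ-false⇒≢ : ∀ {m n} → (m ≡ᵇ n) ≡ false → m ≢ n
≡ᵇ-false⇒≢ {m} {n} eq m≡n = subst Bool.T eq (≡⇒≡ᵇ m n m≡n)

module _ (σ : List ℕ) where

  orbitTail-closes : ∀ f h x → length (orbitTail f σ h (nth σ x)) < f → Chain (nth σ) h (x ∷ orbitTail f σ h (nth σ x))
  orbitTail-closes (suc f) h x lt with nth σ x ≡ᵇ h in eq
  ... | true  = ≡ᵇ-true⇒≡ eq
  ... | false = refl , orbitTail-closes f h (nth σ x) (≤-pred lt)

  orbitTail-chain : ∀ f h x l → Chain (nth σ) h (x ∷ l) → h ∉ l → length l < f → orbitTail f σ h (nth σ x) ≡ l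
  orbitTail-chain (suc f) h x [] σx≡h _ _ with nth σ x ≡ᵇ h in eq
  ... | true  = refl
  ... | false = contradiction σx≡h (≡ᵇ-false⇒≢ eq)
  orbitTail-chain (suc f) h x (y ∷ l) (σx≡y , c) h∉ (s≤s lt) with nth σ x ≡ᵇ h in eq
  ... | true  = contradiction (here (trans (sym (≡ᵇ-true⇒≡ eq)) σx≡y)) h∉
  ... | false rewrite σx≡y = cong (y ∷_) (orbitTail-chain f h y l c (λ h∈ → h∉ (there h∈)) lt)

  orbitTail-reaches : ∀ f h x y u → Chain (nth σ) h (y ∷ u) → x ∉ u → x ≢ h → length u < f →
      h ∈ orbitTail f σ x (nth σ y)
  orbitTail-reaches (suc f) h x y [] σy≡h _ x≢h _ with nth σ y ≡ᵇ x in eq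
  ... | true  = contradiction (trans (sym (≡ᵇ-true⇒≡ eq)) σy≡h) x≢h
  ... | false = here (sym σy≡h)
  orbitTail-reaches (suc f) h x y (z ∷ u) (σy≡z , c) x∉ x≢h (s≤s lt) with nth σ y ≡ᵇ x in eq
  ... | true  = contradiction (here (trans (sym (≡ᵇ-true⇒≡ eq)) σy≡z)) x∉
  ... | false rewrite σy≡z = there (orbitTail-reaches f h x z u c (λ x∈ → x∉ (there x∈)) x≢h lt)

data StandardForm : ℕ → List (List ℕ) → Set where
  []   : ∀ {b} → StandardForm b []
  cons : ∀ {b h t bs} → b < h → All (_≤ h) t → StandardForm h bs → StandardForm b ((h ∷ t) ∷ bs)

HeadAbove : ℕ → List ℕ → Set
HeadAbove h []      = ⊤
HeadAbove h (c ∷ _) = h < c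

StandardForm-headAbove : ∀ {b bs} → StandardForm b bs → HeadAbove b (concat bs)
StandardForm-headAbove []             = tt
StandardForm-headAbove (cons b<h _ _) = b<h

-- Walk s M π: s is the permutation θ⁻¹ reads off π, when the entries read before π have maximum M.
Walk : (ℕ → ℕ) → ℕ → List ℕ → Set
Walk s M []          = ⊤
Walk s M (a ∷ [])    = s a ≡ M ⊔ a
Walk s M (a ∷ c ∷ r) = (c < M ⊔ a → s a ≡ c) × (M ⊔ a ≤ c → s a ≡ M ⊔ a) × Walk s (M ⊔ a) (c ∷ r)

Walk-++-cycle : ∀ {s h} M x t rest → M ⊔ x ≡ h → All (_≤ h) t → Chain s h (x ∷ t) → HeadAbove h rest →
    Walk s h rest → Walk s M (x ∷ t ++ rest)
Walk-++-cycle M x [] [] M⊔x≡h _ sx≡h _ _ = trans sx≡h (sym M⊔x≡h)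
Walk-++-cycle M x [] (c ∷ r) M⊔x≡h _ sx≡h h<c w =
  (λ c<M⊔x → contradiction (subst (c <_) M⊔x≡h c<M⊔x) (<-asym h<c)) ,
  (λ _ → trans sx≡h (sym M⊔x≡h)) ,
  subst (λ z → Walk _ z (c ∷ r)) (sym M⊔x≡h) w
Walk-++-cycle M x (y ∷ t) rest M⊔x≡h (y≤h ∷ t≤h) (sx≡y , c) h<rest w =
  (λ _ → sx≡y) ,
  (λ M⊔x≤y → trans sx≡y (≤-antisym (subst (y ≤_) (sym M⊔x≡h) y≤h) M⊔x≤y)) ,
  Walk-++-cycle (M ⊔ x) y t rest (trans (cong (_⊔ y) M⊔x≡h) (m≥n⇒m⊔n≡m y≤h)) t≤h c h<rest w

StandardForm⇒Walk : ∀ {s b bs} → StandardForm b bs → All (IsCycle s) bs → Walk s b (concat bs)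
StandardForm⇒Walk []                          []      = tt
StandardForm⇒Walk {bs = (h ∷ t) ∷ bs} (cons b<h t≤h sf) (c ∷ cs) =
  Walk-++-cycle _ h t (concat bs) (m≤n⇒m⊔n≡n (<⇒≤ b<h)) t≤h c (StandardForm-headAbove sf) (StandardForm⇒Walk sf cs)

module _ (σ : List ℕ) where

  cycleMaxima : List ℕ
  cycleMaxima = filterᵇ (isCycleMax σ) [1‥ length σ ]

  cycleFrom-≤ : ∀ h → Bool.T (isCycleMax σ h) → All (_≤ h) (orbitTail (length σ) σ h (nth σ h))
  cycleFrom-≤ h max with all⁺ (_≤ᵇ h) (cycleFrom σ h) max
  ... | _ ∷ t≤h = All-map (≤ᵇ⇒≤ _ h) t≤h

  standardCycleForm-standard : StandardForm 0 (standardCycleForm σ)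
  standardCycleForm-standard = go 0 cycleMaxima (AllPairsₚ.filter⁺ _ ([1‥]-increasing (length σ)))
    (All-tabulate (λ h∈ → proj₁ (∈-[1‥]⁻ (length σ) (proj₁ (∈-filter⁻ _ h∈)))))
    (All-tabulate (λ h∈ → proj₂ (∈-filter⁻ _ {xs = [1‥ length σ ]} h∈)))
    where
    go : ∀ b hs → AllPairs _<_ hs → All (b <_) hs → All (Bool.T ∘ isCycleMax σ) hs →
        StandardForm b (map (cycleFrom σ) hs)
    go b []       _            _          _          = []
    go b (h ∷ hs) (h< ∷ hs↑) (b<h ∷ b<hs) (max ∷ maxs) = cons b<h (cycleFrom-≤ h max) (go h hs hs↑ h< maxs)

  standardCycleForm-cycles : length (θ σ) ≤ length σ → All (IsCycle (nth σ)) (standardCycleForm σ)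
  standardCycleForm-cycles θσ≤ = go cycleMaxima (λ c∈ → ≤-trans (length-∈-concat c∈) θσ≤)
    where
    length-∈-concat : ∀ {c : List ℕ} {cs} → c ∈ cs → length c ≤ length (concat cs)
    length-∈-concat {c} {_ ∷ cs} (here refl) = length-++-≤ˡ c
    length-∈-concat {_} {d ∷ cs} (there c∈)  = ≤-trans (length-∈-concat c∈) (length-++-≤ʳ (concat cs) {d})
    go : ∀ hs → (∀ {c} → c ∈ map (cycleFrom σ) hs → length c ≤ length σ) → All (IsCycle (nth σ)) (map (cycleFrom σ) hs)
    go []       _ = []
    go (h ∷ hs) short = orbitTail-closes σ (length σ) h h (short (here refl)) ∷ go hs (short ∘ there)

  θ-walk : length (θ σ) ≤ length σ → Walk (nth σ) 0 (θ σ)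
  θ-walk θσ≤ = StandardForm⇒Walk standardCycleForm-standard (standardCycleForm-cycles θσ≤)

heads : List (List ℕ) → List ℕ
heads []             = []
heads ([] ∷ bs)      = heads bs
heads ((h ∷ _) ∷ bs) = h ∷ heads bs

∈-heads⁺ : ∀ {h t bs} → (h ∷ t) ∈ bs → h ∈ heads bs
∈-heads⁺ {bs = _ ∷ _}       (here refl) = here refl
∈-heads⁺ {bs = [] ∷ _}      (there b∈)  = ∈-heads⁺ b∈
∈-heads⁺ {bs = (_ ∷ _) ∷ _} (there b∈)  = there (∈-heads⁺ b∈)

∈-heads⁻ : ∀ {h} bs → h ∈ heads bs → Σ (List ℕ) λ t → (h ∷ t) ∈ bs
∈-heads⁻ ([] ∷ bs)      h∈          = let t , b∈ = ∈-heads⁻ bs h∈ in t , there b∈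
∈-heads⁻ ((_ ∷ t) ∷ bs) (here refl) = t , here refl
∈-heads⁻ ((_ ∷ _) ∷ bs) (there h∈)  = let t , b∈ = ∈-heads⁻ bs h∈ in t , there b∈

StandardForm-heads : ∀ {b bs} → StandardForm b bs → All (b <_) (heads bs) × AllPairs _<_ (heads bs)
StandardForm-heads []               = [] , []
StandardForm-heads (cons b<h _ sf) with StandardForm-heads sf
... | h< , hs↑ = (b<h ∷ All-map (<-trans b<h) h<) , (h< ∷ hs↑)

module Cycles (σ : List ℕ) where

  -- The length bound is what the fuel of cycleFrom requires.
  MaxCycle : List ℕ → Set
  MaxCycle []      = ⊥
  MaxCycle (h ∷ t) = Chain (nth σ) h (h ∷ t) × All (_≤ h) t × Unique (h ∷ t) × length t < length σ

  standardForm-maxCycles : ∀ {b bs} → StandardForm b bs → All (IsCycle (nth σ)) bs →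
      Unique (concat bs) → length (concat bs) ≤ length σ → All MaxCycle bs
  standardForm-maxCycles []                                 []       _ _ = []
  standardForm-maxCycles {bs = (h ∷ t) ∷ bs} (cons _ t≤h sf) (c ∷ cs) u short =
    (c , t≤h , proj₁ (Unique-++⁻ (h ∷ t) u) , ≤-trans (s≤s (m≤m+n _ _)) short′) ∷
    standardForm-maxCycles sf cs (proj₂ (Unique-++⁻ (h ∷ t) u))
      (≤-trans (m≤n+m _ _) (≤-trans (n≤1+n _) short′))
    where
    short′ : suc (length t + length (concat bs)) ≤ length σ
    short′ = subst (_≤ length σ) (cong suc (length-++ t)) short

  cycleFrom-maxCycle : ∀ {h t} → MaxCycle (h ∷ t) → cycleFrom σ h ≡ h ∷ t
  cycleFrom-maxCycle {h} {t} (c , _ , u , short) = cong (h ∷_)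
      (orbitTail-chain σ (length σ) h h t c (Unique[x∷xs]⇒x∉xs u) short)

  maxCycle-isCycleMax : ∀ {h t} → MaxCycle (h ∷ t) → Bool.T (isCycleMax σ h)
  maxCycle-isCycleMax {h} mc@(_ , t≤h , _) =
    subst (Bool.T ∘ all (_≤ᵇ h)) (sym (cycleFrom-maxCycle mc))
        (all⁻ (_≤ᵇ h) {h ∷ _} (≤⇒≤ᵇ (≤-refl {h}) ∷ All-map ≤⇒≤ᵇ t≤h))

  maxCycle-¬isCycleMax : ∀ {h t x} → MaxCycle (h ∷ t) → x ∈ t → ¬ Bool.T (isCycleMax σ x)
  maxCycle-¬isCycleMax {h} {t} {x} (c , t≤h , u , short) x∈t max with ∈-∃++ x∈t
  ... | us , vs , refl = <⇒≱ x<h (≤ᵇ⇒≤ h x (All-lookup (all⁺ (_≤ᵇ x) (cycleFrom σ x) max) (there h∈orbit)))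
    where
    x<h : x < h
    x<h = ≤∧≢⇒< (All-lookup t≤h x∈t) (λ { refl → Unique[x∷xs]⇒x∉xs u x∈t })
    h∈orbit : h ∈ orbitTail (length σ) σ x (nth σ x)
    h∈orbit = orbitTail-reaches σ (length σ) h x x vs (Chain-suffix (h ∷ us) c)
      (Unique[x∷xs]⇒x∉xs (proj₂ (Unique-++⁻ (h ∷ us) u))) (<⇒≢ x<h)
      (<-trans (length-++-≤ʳ (x ∷ vs) {us}) short)

  θ-standardForm : ∀ {bs} → StandardForm 0 bs → All MaxCycle bs →
      (∀ {x} → x ∈ concat bs → x ∈ [1‥ length σ ]) → (∀ {x} → x ∈ [1‥ length σ ] → x ∈ concat bs) →
      θ σ ≡ concat bs
  θ-standardForm {bs} sf mcs ⊆ ⊇ =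
    cong concat (trans (cong (map (cycleFrom σ)) maxima≡heads) (cycleFrom-heads mcs))
    where
    cycleFrom-heads : ∀ {cs} → All MaxCycle cs → map (cycleFrom σ) (heads cs) ≡ cs
    cycleFrom-heads {[]}          []         = refl
    cycleFrom-heads {(_ ∷ _) ∷ _} (mc ∷ mcs) = cong₂ _∷_ (cycleFrom-maxCycle mc) (cycleFrom-heads mcs)
    maxima⊆heads : ∀ {x} → x ∈ cycleMaxima σ → x ∈ heads bs
    maxima⊆heads x∈ with ∈-filter⁻ (T? ∘ isCycleMax σ) {xs = [1‥ length σ ]} x∈
    ... | x∈[1‥] , max with ∈-concat⁻′ bs (⊇ x∈[1‥])
    ...   | [] , () , _
    ...   | (h ∷ t) , here refl , b∈ = ∈-heads⁺ b∈
    ...   | (h ∷ t) , there x∈t , b∈ = contradiction max (maxCycle-¬isCycleMax (All-lookup mcs b∈) x∈t)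
    heads⊆maxima : ∀ {x} → x ∈ heads bs → x ∈ cycleMaxima σ
    heads⊆maxima {x} x∈ with ∈-heads⁻ bs x∈
    ... | t , b∈ = ∈-filter⁺ (T? ∘ isCycleMax σ) (⊆ (∈-concat⁺′ (here refl) b∈))
        (maxCycle-isCycleMax (All-lookup mcs b∈))
    maxima≡heads : cycleMaxima σ ≡ heads bs
    maxima≡heads = increasing-ext (AllPairsₚ.filter⁺ _ ([1‥]-increasing (length σ)))
        (proj₂ (StandardForm-heads sf)) maxima⊆heads heads⊆maxima


-- θ is onto

cutAt : ℕ → List ℕ → List ℕ → List (List ℕ)
cutAt h t []      = (h ∷ t) ∷ []
cutAt h t (c ∷ r) with c ≤? h
... | yes _ = cutAt h (t ∷ʳ c) r
... | no  _ = (h ∷ t) ∷ cutAt c [] r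

cutAt-concat : ∀ h t r → concat (cutAt h t r) ≡ h ∷ t ++ r
cutAt-concat h t []      = refl
cutAt-concat h t (c ∷ r) with c ≤? h
... | yes _ = trans (cutAt-concat h (t ∷ʳ c) r) (cong (h ∷_) (++-assoc t [ c ] r))
... | no  _ = cong (h ∷_) (cong (t ++_) (cutAt-concat c [] r))

cutAt-standardForm : ∀ {b} h t r → b < h → All (_≤ h) t → StandardForm b (cutAt h t r)
cutAt-standardForm h t []      b<h t≤h = cons b<h t≤h []
cutAt-standardForm h t (c ∷ r) b<h t≤h with c ≤? h
... | yes c≤h = cutAt-standardForm h (t ∷ʳ c) r b<h (All-++⁺ t≤h (c≤h ∷ []))
... | no  c≰h = cons b<h t≤h (cutAt-standardForm c [] r (≰⇒> c≰h) [])

chainArrows : ℕ → List ℕ → List (ℕ × ℕ)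
chainArrows h []          = []
chainArrows h (x ∷ [])    = (x , h) ∷ []
chainArrows h (x ∷ y ∷ r) = (x , y) ∷ chainArrows h (y ∷ r)

cycleArrows : List ℕ → List (ℕ × ℕ)
cycleArrows []      = []
cycleArrows (h ∷ t) = chainArrows h (h ∷ t)

chainArrows-sources : ∀ h l → map proj₁ (chainArrows h l) ≡ l
chainArrows-sources h []          = refl
chainArrows-sources h (x ∷ [])    = refl
chainArrows-sources h (x ∷ y ∷ r) = cong (x ∷_) (chainArrows-sources h (y ∷ r))

chainArrows-targets : ∀ h x l → map proj₂ (chainArrows h (x ∷ l)) ↭ h ∷ l
chainArrows-targets h x []      = ↭-refl
chainArrows-targets h x (y ∷ l) = ↭-trans (prep y (chainArrows-targets h y l)) (swap y h ↭-refl)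

chainArrows⇒Chain : ∀ {s} h l → All (λ (k , v) → s k ≡ v) (chainArrows h l) → Chain s h l
chainArrows⇒Chain h []          _          = tt
chainArrows⇒Chain h (x ∷ [])    (e ∷ [])   = e
chainArrows⇒Chain h (x ∷ y ∷ r) (e ∷ es)   = e , chainArrows⇒Chain h (y ∷ r) es

arrowsOf : List (List ℕ) → List (ℕ × ℕ)
arrowsOf = concatMap cycleArrows

arrowsOf-sources : ∀ bs → map proj₁ (arrowsOf bs) ≡ concat bs
arrowsOf-sources []       = refl
arrowsOf-sources (b ∷ bs) = trans (map-++ proj₁ (cycleArrows b) (arrowsOf bs))
  (cong₂ _++_ (chainArrows-sources-cycle b) (arrowsOf-sources bs))
  where
  chainArrows-sources-cycle : ∀ b → map proj₁ (cycleArrows b) ≡ b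
  chainArrows-sources-cycle []      = refl
  chainArrows-sources-cycle (h ∷ t) = chainArrows-sources h (h ∷ t)

arrowsOf-targets : ∀ bs → map proj₂ (arrowsOf bs) ↭ concat bs
arrowsOf-targets []            = ↭-refl
arrowsOf-targets ([] ∷ bs)     = arrowsOf-targets bs
arrowsOf-targets ((h ∷ t) ∷ bs) =
  subst (_↭ h ∷ t ++ concat bs) (sym (map-++ proj₂ (chainArrows h (h ∷ t)) (arrowsOf bs)))
    (++⁺ (chainArrows-targets h h t) (arrowsOf-targets bs))

StandardForm-arrows⇒cycles : ∀ {s b bs} → StandardForm b bs → All (λ (k , v) → s k ≡ v) (arrowsOf bs) →
    All (IsCycle s) bs
StandardForm-arrows⇒cycles []                                 _  = []
StandardForm-arrows⇒cycles {bs = (h ∷ t) ∷ bs} (cons _ _ sf) es =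
  chainArrows⇒Chain h (h ∷ t) (++⁻ˡ (chainArrows h (h ∷ t)) es) ∷
  StandardForm-arrows⇒cycles sf (++⁻ʳ (chainArrows h (h ∷ t)) es)

assoc : List (ℕ × ℕ) → ℕ → ℕ
assoc []              x = 0
assoc ((k , v) ∷ kvs) x with x ≟ k
... | yes _ = v
... | no  _ = assoc kvs x

assoc-∈ : ∀ kvs {k v} → Unique (map proj₁ kvs) → (k , v) ∈ kvs → assoc kvs k ≡ v
assoc-∈ ((k , v) ∷ kvs) _ (here refl) with k ≟ k
... | yes _   = refl
... | no k≢k = contradiction refl k≢k
assoc-∈ ((k′ , v′) ∷ kvs) {k} (k′∉ ∷ u) (there kv∈) with k ≟ k′
... | yes refl = contradiction refl (All-lookup k′∉ (∈-map⁺ proj₁ kv∈))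
... | no  _    = assoc-∈ kvs u kv∈

-- σ is read off π cut into blocks at its left-to-right maxima, each block being a cycle.
module Preimage (n h : ℕ) (r : List ℕ) (perm : h ∷ r ↭ [1‥ n ]) where

  blocks : List (List ℕ)
  blocks = cutAt h [] r

  P : List (ℕ × ℕ)
  P = arrowsOf blocks

  σ : List ℕ
  σ = map (assoc P) [1‥ n ]

  length-σ : length σ ≡ n
  length-σ = trans (length-map _ [1‥ n ]) (length-applyUpTo suc n)

  concat-blocks : concat blocks ≡ h ∷ r
  concat-blocks = cutAt-concat h [] r

  standard : StandardForm 0 blocks
  standard = cutAt-standardForm h [] r (proj₁ (∈-[1‥]⁻ n (∈-resp-↭ perm (here refl)))) []

  unique : Unique (concat blocks)
  unique = subst Unique (sym concat-blocks) (Unique-resp-↭ (↭-sym perm) ([1‥]-unique n))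

  sources : map proj₁ P ≡ h ∷ r
  sources = trans (arrowsOf-sources blocks) concat-blocks

  assoc-arrows : All (λ (k , v) → assoc P k ≡ v) P
  assoc-arrows = All-tabulate (assoc-∈ P (subst Unique (sym (arrowsOf-sources blocks)) unique))

  σ-arrows : All (λ (k , v) → nth σ k ≡ v) P
  σ-arrows = All-tabulate λ {(k , v)} kv∈ →
    trans (nth-σ (∈-resp-↭ perm (subst (k ∈_) sources (∈-map⁺ proj₁ kv∈)))) (All-lookup assoc-arrows kv∈)
    where
    nth-σ : ∀ {x} → x ∈ [1‥ n ] → nth σ x ≡ assoc P x
    nth-σ x∈ with ∈-applyUpTo⁻ suc x∈
    ... | i , i<n , refl = nth-map-applyUpTo _ suc n i i<n

  σ-perm : σ ↭ [1‥ n ]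
  σ-perm = begin
    map (assoc P) [1‥ n ]        ↭⟨ map⁺ (assoc P) (↭-sym perm) ⟩
    map (assoc P) (h ∷ r)        ≡⟨ cong (map (assoc P)) (sym sources) ⟩
    map (assoc P) (map proj₁ P)  ≡⟨ sym (map-∘ P) ⟩
    map (assoc P ∘ proj₁) P      ≡⟨ map-cong-local assoc-arrows ⟩
    map proj₂ P                  ↭⟨ arrowsOf-targets blocks ⟩
    concat blocks                ≡⟨ concat-blocks ⟩
    h ∷ r                        ↭⟨ perm ⟩
    [1‥ n ]                      ∎
    where open PermutationReasoning

  θσ : θ σ ≡ h ∷ r
  θσ = trans (θ-standardForm standard maxCycles ⊆ ⊇) concat-blocks
    where
    open Cycles σ
    maxCycles : All MaxCycle blocks
    maxCycles = standardForm-maxCycles standard (StandardForm-arrows⇒cycles standard σ-arrows) unique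
      (≤-reflexive (trans (cong length concat-blocks) (trans (IsPerm-length perm) (sym length-σ))))
    ⊆ : ∀ {x} → x ∈ concat blocks → x ∈ [1‥ length σ ]
    ⊆ x∈ = subst (λ m → _ ∈ [1‥ m ]) (sym length-σ) (∈-resp-↭ perm (subst (_ ∈_) concat-blocks x∈))
    ⊇ : ∀ {x} → x ∈ [1‥ length σ ] → x ∈ concat blocks
    ⊇ x∈ = subst (_ ∈_) (sym concat-blocks) (∈-resp-↭ (↭-sym perm) (subst (λ m → _ ∈ [1‥ m ]) length-σ x∈))

θ-surjective : ∀ n π → IsPerm n π → Σ (List ℕ) λ σ → IsPerm n σ × θ σ ≡ π
θ-surjective n []      perm = [] , perm , refl
θ-surjective n (h ∷ r) perm = σ , σ-perm , θσ
  where open Preimage n h r perm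


-- Fixed points and (12;2→3) read off the word

NoFixedPoint : (ℕ → ℕ) → List ℕ → Set
NoFixedPoint s π = ∀ {a} → a ∈ π → s a ≢ a

No12-2→3 : (ℕ → ℕ) → List ℕ → Set
No12-2→3 s π = ∀ u a v {e} → π ≡ u ++ a ∷ v → e ∈ u → e < a → s a ≤ a

-- m is the least entry read so far; an entry that is not a new minimum must be followed by a
-- smaller one.
MinOrDescent : ℕ → List ℕ → Set
MinOrDescent m []          = ⊤
MinOrDescent m (a ∷ [])    = ⊤
MinOrDescent m (a ∷ c ∷ r) = (a < m ⊎ c < a) × MinOrDescent (m ⊓ a) (c ∷ r)

MinOrDescentLastMin : ℕ → List ℕ → Set
MinOrDescentLastMin m []          = ⊤
MinOrDescentLastMin m (a ∷ [])    = a < m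
MinOrDescentLastMin m (a ∷ c ∷ r) = (a < m ⊎ c < a) × MinOrDescentLastMin (m ⊓ a) (c ∷ r)

Good : List ℕ → Set
Good (a ∷ b ∷ r) = b < a × MinOrDescentLastMin a (b ∷ r)
Good _           = ⊥

MinOrDescent-tail : ∀ {m a ρ} → MinOrDescent m (a ∷ ρ) → MinOrDescent (m ⊓ a) ρ
MinOrDescent-tail {ρ = []}    _       = tt
MinOrDescent-tail {ρ = _ ∷ _} (_ , g) = g

MinOrDescentLastMin-tail : ∀ {m a ρ} → MinOrDescentLastMin m (a ∷ ρ) → MinOrDescentLastMin (m ⊓ a) ρ
MinOrDescentLastMin-tail {ρ = []}    _       = tt
MinOrDescentLastMin-tail {ρ = _ ∷ _} (_ , g) = g

Walk-tail : ∀ {s M a ρ} → Walk s M (a ∷ ρ) → Walk s (M ⊔ a) ρ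
Walk-tail {ρ = []}    _           = tt
Walk-tail {ρ = _ ∷ _} (_ , _ , w) = w

-- Along the rest ρ of the word: p is the part already read, mn its minimum and M its maximum
-- (the lemmas use only the stated relations between them).
module _ {s : ℕ → ℕ} where

  private
    running-bounds : ∀ {M mn a} p → mn ≤ M → All (mn ≤_) p → mn ⊓ a ≤ M ⊔ a × All (mn ⊓ a ≤_) (p ∷ʳ a)
    running-bounds {M} {mn} {a} p mn≤M p≥mn =
      ≤-trans (m⊓n≤m mn a) (≤-trans mn≤M (m≤m⊔n M a)) ,
      All-++⁺ (All-map (≤-trans (m⊓n≤m mn a)) p≥mn) (m⊓n≤n mn a ∷ [])

  MinOrDescentLastMin-head : ∀ {M mn a ρ} → MinOrDescentLastMin mn (a ∷ ρ) → Walk s M (a ∷ ρ) →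
      a ∉ ρ → mn ≤ M → s a ≢ a × (mn < a → s a < a)
  MinOrDescentLastMin-head {M} {mn} {a} {[]} a<mn sa≡M⊔a _ mn≤M =
    (λ sa≡a → <-irrefl (trans (sym sa≡a) (trans sa≡M⊔a (m≥n⇒m⊔n≡m (<⇒≤ a<M)))) a<M) ,
    (λ mn<a → contradiction a<mn (<-asym mn<a))
    where
    a<M : a < M
    a<M = <-≤-trans a<mn mn≤M
  MinOrDescentLastMin-head {M} {mn} {a} {c ∷ r} (inj₂ c<a , _) (to-c , _) _ _ =
    (λ sa≡a → <-irrefl (trans (sym sa≡c) sa≡a) c<a) , (λ _ → subst (_< a) (sym sa≡c) c<a)
    where
    sa≡c : s a ≡ c
    sa≡c = to-c (<-≤-trans c<a (m≤n⊔m M a))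
  MinOrDescentLastMin-head {M} {mn} {a} {c ∷ r} (inj₁ a<mn , _) (to-c , to-max , _) a∉ mn≤M =
    fixed-free , (λ mn<a → contradiction a<mn (<-asym mn<a))
    where
    a<M : a < M
    a<M = <-≤-trans a<mn mn≤M
    fixed-free : s a ≢ a
    fixed-free sa≡a with c <? M ⊔ a
    ... | yes c< = a∉ (here (trans (sym sa≡a) (to-c c<)))
    ... | no  c≮ = <-irrefl (trans (sym sa≡a) (trans (to-max (≮⇒≥ c≮)) (m≥n⇒m⊔n≡m (<⇒≤ a<M)))) a<M

  MinOrDescentLastMin⇒avoids : ∀ {M mn ρ} p → MinOrDescentLastMin mn ρ → Walk s M ρ → Unique ρ →
      mn ≤ M → All (mn ≤_) p →
      ∀ u a v → ρ ≡ u ++ a ∷ v → s a ≢ a × (∀ {e} → e ∈ p ++ u → e < a → s a < a)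
  MinOrDescentLastMin⇒avoids p g w un mn≤M p≥mn [] a v refl =
    let fixed-free , descends = MinOrDescentLastMin-head g w (Unique[x∷xs]⇒x∉xs un) mn≤M
    in fixed-free , λ e∈ e<a → descends (≤-<-trans (All-lookup p≥mn (subst (_ ∈_) (++-identityʳ p) e∈)) e<a)
  MinOrDescentLastMin⇒avoids p g w (_ ∷ un) mn≤M p≥mn (x ∷ u) a v refl =
    let M′≥ , p≥ = running-bounds p mn≤M p≥mn
        fixed-free , descends = MinOrDescentLastMin⇒avoids (p ∷ʳ x) (MinOrDescentLastMin-tail g)
            (Walk-tail w) un M′≥ p≥ u a v refl
    in fixed-free , λ e∈ → descends (subst (_ ∈_) (sym (++-assoc p [ x ] u)) e∈)

  below-or-descends : ∀ {mn a ρ} p → Unique (p ++ a ∷ ρ) → mn ∈ p → s a ≢ a →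
      (∀ u x v {e} → a ∷ ρ ≡ u ++ x ∷ v → e ∈ p ++ u → e < x → s x ≤ x) → a < mn ⊎ s a < a
  below-or-descends {mn = mn} {a} {ρ} p un mn∈ sa≢a np with <-cmp a mn
  ... | tri< a<mn _ _ = inj₁ a<mn
  ... | tri≈ _ refl _ = contradiction (here refl) (Unique-++⇒disjoint p un mn∈)
  ... | tri> _ _ mn<a = inj₂ (≤∧≢⇒< (np [] a ρ refl (subst (mn ∈_) (sym (++-identityʳ p)) mn∈) mn<a) sa≢a)

  avoids⇒MinOrDescentLastMin : ∀ {M mn ρ} p → Walk s M ρ → Unique (p ++ ρ) → mn ∈ p →
      All (mn ≤_) p → mn ≤ M → NoFixedPoint s ρ →
      (∀ u a v {e} → ρ ≡ u ++ a ∷ v → e ∈ p ++ u → e < a → s a ≤ a) → MinOrDescentLastMin mn ρ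
  avoids⇒MinOrDescentLastMin {ρ = []} _ _ _ _ _ _ _ _ = tt
  avoids⇒MinOrDescentLastMin {M} {ρ = a ∷ []} p sa≡M⊔a un mn∈ _ _ nf np
    with below-or-descends p un mn∈ (nf (here refl)) np
  ... | inj₁ a<mn = a<mn
  ... | inj₂ sa<a = contradiction (subst (a ≤_) (sym sa≡M⊔a) (m≤n⊔m M a)) (<⇒≱ sa<a)
  avoids⇒MinOrDescentLastMin {M} {mn} {a ∷ c ∷ r} p (to-c , to-max , w) un mn∈ p≥mn mn≤M nf np =
    head , avoids⇒MinOrDescentLastMin (p ∷ʳ a) w (subst Unique (sym (++-assoc p [ a ] (c ∷ r))) un)
             mn′∈ p≥′ M′≥ (nf ∘ there)
             (λ u x v eq e∈ → np (a ∷ u) x v (cong (a ∷_) eq) (subst (_ ∈_) (++-assoc p [ a ] u) e∈))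
    where
    M′≥ = proj₁ (running-bounds p mn≤M p≥mn)
    p≥′ = proj₂ (running-bounds p mn≤M p≥mn)
    mn′∈ : mn ⊓ a ∈ p ∷ʳ a
    mn′∈ with ⊓-sel mn a
    ... | inj₁ eq = subst (_∈ p ∷ʳ a) (sym eq) (∈-++⁺ˡ mn∈)
    ... | inj₂ eq = subst (_∈ p ∷ʳ a) (sym eq) (∈-++⁺ʳ p (here refl))
    head : a < mn ⊎ c < a
    head with below-or-descends p un mn∈ (nf (here refl)) np
    ... | inj₁ a<mn = inj₁ a<mn
    ... | inj₂ sa<a with c <? M ⊔ a
    ...   | yes c< = inj₂ (subst (_< a) (to-c c<) sa<a)
    ...   | no  c≮ = contradiction (subst (a ≤_) (sym (to-max (≮⇒≥ c≮))) (m≤n⊔m M a)) (<⇒≱ sa<a)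

module _ {s : ℕ → ℕ} (a b : ℕ) (r : List ℕ) (w : Walk s 0 (a ∷ b ∷ r)) (un : Unique (a ∷ b ∷ r)) where

  good⇒avoids : Good (a ∷ b ∷ r) → NoFixedPoint s (a ∷ b ∷ r) × No12-2→3 s (a ∷ b ∷ r)
  good⇒avoids (b<a , g) = no-fixed-point , no-pattern
    where
    sa≡b : s a ≡ b
    sa≡b = proj₁ w b<a
    at-position : ∀ u x v → a ∷ b ∷ r ≡ u ++ x ∷ v → s x ≢ x × (∀ {e} → e ∈ u → e < x → s x < x)
    at-position []      x v refl = (λ sa≡a → <-irrefl (trans (sym sa≡b) sa≡a) b<a) , λ ()
    at-position (y ∷ u) x v eq with ∷-injective eq
    ... | refl , eq′ = MinOrDescentLastMin⇒avoids [ a ] g (proj₂ (proj₂ w))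
        (proj₂ (Unique-++⁻ [ a ] un)) ≤-refl (≤-refl ∷ []) u x v eq′
    no-fixed-point : NoFixedPoint s (a ∷ b ∷ r)
    no-fixed-point x∈ with ∈-∃++ x∈
    ... | u , v , eq = proj₁ (at-position u _ v eq)
    no-pattern : No12-2→3 s (a ∷ b ∷ r)
    no-pattern u x v eq e∈ e<x = <⇒≤ (proj₂ (at-position u x v eq) e∈ e<x)

  avoids⇒good : NoFixedPoint s (a ∷ b ∷ r) → No12-2→3 s (a ∷ b ∷ r) → Good (a ∷ b ∷ r)
  avoids⇒good nf np =
    b<a , avoids⇒MinOrDescentLastMin [ a ] (proj₂ (proj₂ w)) un (here refl) (≤-refl ∷ []) ≤-refl (nf ∘ there)
            (λ u x v eq → np (a ∷ u) x v (cong (a ∷_) eq))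
    where
    b<a : b < a
    b<a with <-cmp b a
    ... | tri< b<a _ _ = b<a
    ... | tri≈ _ refl _ = contradiction (here refl) (Unique[x∷xs]⇒x∉xs un)
    ... | tri> _ _ a<b = contradiction (proj₁ (proj₂ w) (<⇒≤ a<b)) (nf (here refl))


-- Occurrences of the arrow patterns

module Patterns {n : ℕ} {π : List ℕ} (perm : IsPerm n π) where

  length-π : length π ≡ n
  length-π = IsPerm-length perm

  ∈π-bounds : ∀ {y} → y ∈ π → 1 ≤ y × y ≤ n
  ∈π-bounds y∈ = ∈-[1‥]⁻ n (∈-resp-↭ perm y∈)

  σ-bounds : ∀ {σ y} → IsPerm n σ → y ∈ π → 1 ≤ nth σ y × nth σ y ≤ n
  σ-bounds {σ} pσ y∈ with ∈π-bounds y∈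
  ... | s≤s _ , y≤n = ∈-[1‥]⁻ n (∈-resp-↭ pσ (nth-∈ σ _ (subst (_ <_) (sym (IsPerm-length pσ)) y≤n)))

  fixedPoint⇒contains : ∀ {σ a} → IsPerm n σ → θ σ ≡ π → a ∈ π → nth σ a ≡ a → Contains n π pat-1-1→1
  fixedPoint⇒contains {σ} {a} pσ θσ a∈ σa≡a with ∈⇒nth π a∈
  ... | i , i< , πi≡a =
    (λ _ → a) , (λ _ → suc i) ,
    (λ _ _ _ → ∈π-bounds a∈) ,
    (λ { (suc _) _ (s≤s ()) }) ,
    (λ _ _ _ → s≤s z≤n , subst (suc i ≤_) length-π i<) ,
    (λ { (suc _) _ (s≤s ()) }) ,
    (λ _ _ _ → πi≡a) ,
    (λ _ _ _ → σ , pσ , θσ , σa≡a)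

  contains⇒fixedPoint : Contains n π pat-1-1→1 → Σ (List ℕ) λ σ → IsPerm n σ × θ σ ≡ π × ¬ NoFixedPoint (nth σ) π
  contains⇒fixedPoint (x , t , _ , _ , t-bounds , _ , πt≡x , hat)
    with hat 1 1 (here refl) | t 1 in t1≡ | t-bounds 1 (s≤s z≤n) (s≤s z≤n)
  ... | σ , pσ , θσ , σx≡x | suc i | _ , t≤n =
    σ , pσ , θσ , λ nf → nf x1∈ σx≡x
    where
    x1∈ : x 1 ∈ π
    x1∈ = subst (_∈ π) (trans (cong (nth π) (sym t1≡)) (πt≡x 1 (s≤s z≤n) (s≤s z≤n)))
        (nth-∈ π i (subst (i <_) (sym length-π) t≤n))

  pattern⇒contains : ∀ {σ u a v e} → IsPerm n σ → θ σ ≡ π → π ≡ u ++ a ∷ v → e ∈ u → e < a →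
      a < nth σ a → Contains n π pat-12-2→3
  pattern⇒contains {σ} {u} {a} {v} {e} pσ θσ π≡ e∈u e<a a<σa with ∈⇒nth u e∈u
  ... | i , i<u , ui≡e = x , t , x-bounds , x-increasing , t-bounds , t-increasing , πt≡x , hat
    where
    a∈π : a ∈ π
    a∈π = subst (a ∈_) (sym π≡) (∈-++⁺ʳ u (here refl))
    e∈π : e ∈ π
    e∈π = subst (e ∈_) (sym π≡) (∈-++⁺ˡ e∈u)
    a-position≤n : suc (length u) ≤ n
    a-position≤n = subst (suc (length u) ≤_)
        (trans (sym (length-++-sucʳ u a v)) (trans (cong length (sym π≡)) length-π))
                     (s≤s (length-++-≤ˡ u))
    x : ℕ → ℕ
    x 1 = e
    x 2 = a
    x _ = nth σ a
    t : ℕ → ℕ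
    t 1 = suc i
    t _ = suc (length u)
    x-bounds : ∀ k → 1 ≤ k → k ≤ 3 → 1 ≤ x k × x k ≤ n
    x-bounds 1                   _ _ = ∈π-bounds e∈π
    x-bounds 2                   _ _ = ∈π-bounds a∈π
    x-bounds (suc (suc (suc _))) _ _ = σ-bounds pσ a∈π
    x-increasing : ∀ k → 1 ≤ k → k < 3 → x k < x (suc k)
    x-increasing 1                   _ _ = e<a
    x-increasing 2                   _ _ = a<σa
    x-increasing (suc (suc (suc _))) _ (s≤s (s≤s (s≤s ())))
    t-bounds : ∀ j → 1 ≤ j → j ≤ 2 → 1 ≤ t j × t j ≤ n
    t-bounds 1             _ _ = s≤s z≤n , ≤-trans (n≤1+n _) (≤-trans (s≤s i<u) a-position≤n)
    t-bounds (suc (suc _)) _ _ = s≤s z≤n , a-position≤n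
    t-increasing : ∀ j → 1 ≤ j → j < 2 → t j < t (suc j)
    t-increasing 1             _ _ = s≤s i<u
    t-increasing (suc (suc _)) _ (s≤s (s≤s ()))
    πt≡x : ∀ j → 1 ≤ j → j ≤ 2 → nth π (t j) ≡ x (nth (1 ∷ 2 ∷ []) j)
    πt≡x 1                   _ _ = trans (cong (λ l → nth l (suc i)) π≡) (trans (nth-++ˡ u (a ∷ v) i i<u) ui≡e)
    πt≡x 2                   _ _ = trans (cong (λ l → nth l (suc (length u))) π≡) (nth-++-∷ u a v)
    πt≡x (suc (suc (suc _))) _ (s≤s (s≤s ()))
    hat : ∀ b c → (b , c) ∈ (2 , 3) ∷ [] → Hat n π (x b) (x c)
    hat .2 .3 (here refl) = σ , pσ , θσ , refl

  contains⇒pattern : Contains n π pat-12-2→3 → Σ (List ℕ) λ σ → IsPerm n σ × θ σ ≡ π × ¬ No12-2→3 (nth σ) π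
  contains⇒pattern (x , t , _ , x-increasing , t-bounds , t-increasing , πt≡x , hat)
    with t 1 in t1≡ | t 2 in t2≡ | t-bounds 1 (s≤s z≤n) (s≤s z≤n) | t-bounds 2 (s≤s z≤n) ≤-refl
       | t-increasing 1 ≤-refl ≤-refl
  ... | suc i | suc j | _ | _ , t2≤n | s≤s i<j with hat 2 3 (here refl)
  ...   | σ , pσ , θσ , σx₂≡x₃ = σ , pσ , θσ , λ np →
    <⇒≱ (subst (x 2 <_) (sym σx₂≡x₃) (x-increasing 2 (s≤s z≤n) ≤-refl))
        (np (take j π) (x 2) (drop (suc j) π) π≡ x₁∈ (x-increasing 1 ≤-refl (s≤s (s≤s z≤n))))
    where
    j<π : j < length π
    j<π = subst (j <_) (sym length-π) t2≤n
    π≡ : π ≡ take j π ++ x 2 ∷ drop (suc j) π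
    π≡ = trans (split-at-nth π j j<π)
           (cong (λ y → take j π ++ y ∷ drop (suc j) π) (trans (cong (nth π) (sym t2≡)) (πt≡x 2 (s≤s z≤n) ≤-refl)))
    x₁∈ : x 1 ∈ take j π
    x₁∈ = subst (_∈ take j π) (trans (cong (nth π) (sym t1≡)) (πt≡x 1 ≤-refl (s≤s z≤n)))
        (nth-∈-take π i j i<j (<⇒≤ j<π))

avoiders⇔good : ∀ {n π} → IsPerm n π → 2 ≤ n → (Avoids n π pat-12-2→3 × Avoids n π pat-1-1→1) ⇔ Good π
avoiders⇔good {π = []}    perm 2≤n = contradiction (subst (2 ≤_) (sym (IsPerm-length perm)) 2≤n) λ ()
avoiders⇔good {π = _ ∷ []} perm 2≤n = contradiction (subst (2 ≤_) (sym (IsPerm-length perm)) 2≤n) λ { (s≤s ()) }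
avoiders⇔good {n} {a ∷ b ∷ r} perm _ = mk⇔ to from
  where
  open Patterns perm
  un : Unique (a ∷ b ∷ r)
  un = Unique-resp-↭ (↭-sym perm) ([1‥]-unique n)
  walk : ∀ {σ} → IsPerm n σ → θ σ ≡ a ∷ b ∷ r → Walk (nth σ) 0 (a ∷ b ∷ r)
  walk {σ} pσ θσ = subst (Walk (nth σ) 0) θσ
      (θ-walk σ (≤-reflexive (trans (cong length θσ) (trans length-π (sym (IsPerm-length pσ))))))
  to : Avoids n (a ∷ b ∷ r) pat-12-2→3 × Avoids n (a ∷ b ∷ r) pat-1-1→1 → Good (a ∷ b ∷ r)
  to (av12 , av1) with θ-surjective n _ perm
  ... | σ , pσ , θσ = avoids⇒good a b r (walk pσ θσ) un
    (λ x∈ σx≡x → av1 (fixedPoint⇒contains pσ θσ x∈ σx≡x))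
    (λ u x v π≡ e∈ e<x → ≮⇒≥ (av12 ∘ pattern⇒contains pσ θσ π≡ e∈ e<x))
  from : Good (a ∷ b ∷ r) → Avoids n (a ∷ b ∷ r) pat-12-2→3 × Avoids n (a ∷ b ∷ r) pat-1-1→1
  from good = (λ c → let σ , pσ , θσ , ¬np = contains⇒pattern c in ¬np (proj₂ (good⇒avoids a b r (walk pσ θσ) un good)))
            , (λ c → let σ , pσ , θσ , ¬nf = contains⇒fixedPoint c
                     in ¬nf (proj₁ (good⇒avoids a b r (walk pσ θσ) un good)))


-- Admissible words

Admissible : List ℕ → Set
Admissible []          = ⊥
Admissible (a ∷ [])    = ⊤
Admissible (a ∷ b ∷ r) = b < a × MinOrDescent a (b ∷ r)

MinOrDescent-decreasing : ∀ {m γ} → Linked _>_ γ → MinOrDescent m γ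
MinOrDescent-decreasing []          = tt
MinOrDescent-decreasing [-]         = tt
MinOrDescent-decreasing (d<c ∷ γ↓) = inj₂ d<c , MinOrDescent-decreasing γ↓

MinOrDescent-min∷decreasing : ∀ {m w γ} → w < m → Linked _>_ γ → MinOrDescent m (w ∷ γ)
MinOrDescent-min∷decreasing {γ = []}    _   _  = tt
MinOrDescent-min∷decreasing {γ = _ ∷ _} w<m γ↓ = inj₁ w<m , MinOrDescent-decreasing γ↓

MinOrDescent-++-min∷decreasing : ∀ {m w γ} a r → MinOrDescent m (a ∷ r) → All (w <_) (a ∷ r) →
    w < m → Linked _>_ γ → MinOrDescent m (a ∷ r ++ w ∷ γ)
MinOrDescent-++-min∷decreasing a []      _       (w<a ∷ [])  w<m γ↓ =
  inj₂ w<a , MinOrDescent-min∷decreasing (⊓-pres-m< w<m w<a) γ↓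
MinOrDescent-++-min∷decreasing a (b ∷ r) (d , g) (w<a ∷ w<r) w<m γ↓ =
  d , MinOrDescent-++-min∷decreasing b r g w<r (⊓-pres-m< w<m w<a) γ↓

Admissible-++-min∷decreasing : ∀ {w γ} β → Admissible β → All (w <_) β → Linked _>_ γ → Admissible (β ++ w ∷ γ)
Admissible-++-min∷decreasing (a ∷ [])    _         (w<a ∷ [])  γ↓ = w<a , MinOrDescent-min∷decreasing w<a γ↓
Admissible-++-min∷decreasing (a ∷ b ∷ r) (b<a , g) (w<a ∷ w<r) γ↓ =
  b<a , MinOrDescent-++-min∷decreasing b r g w<r w<a γ↓

MinOrDescent-prefix : ∀ {m} β {δ} → MinOrDescent m (β ++ δ) → MinOrDescent m β
MinOrDescent-prefix []          _       = tt
MinOrDescent-prefix (a ∷ [])    _       = tt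
MinOrDescent-prefix (a ∷ b ∷ r) (d , g) = d , MinOrDescent-prefix (b ∷ r) g

Admissible-prefix : ∀ a r {δ} → Admissible (a ∷ r ++ δ) → Admissible (a ∷ r)
Admissible-prefix a []      _         = tt
Admissible-prefix a (b ∷ r) (b<a , g) = b<a , MinOrDescent-prefix (b ∷ r) g

MinOrDescent-suffix : ∀ {m} β {δ} → MinOrDescent m (β ++ δ) → Σ ℕ λ k → MinOrDescent k δ
MinOrDescent-suffix {m} []      g = m , g
MinOrDescent-suffix     (a ∷ β) g = MinOrDescent-suffix β (MinOrDescent-tail g)

MinOrDescent-above-decreasing : ∀ {k w γ} → k ≤ w → All (w <_) γ → MinOrDescent k γ → Linked _>_ γ
MinOrDescent-above-decreasing {γ = []}        _   _            _                = []
MinOrDescent-above-decreasing {γ = _ ∷ []}    _   _            _                = [-]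
MinOrDescent-above-decreasing {γ = c ∷ d ∷ r} k≤w (w<c ∷ _) (inj₁ c<k , _) =
  contradiction (<-≤-trans c<k (≤-trans k≤w (<⇒≤ w<c))) (<-irrefl refl)
MinOrDescent-above-decreasing {γ = c ∷ d ∷ r} k≤w (_ ∷ w<dr) (inj₂ d<c , g) =
  d<c ∷ MinOrDescent-above-decreasing (≤-trans (m⊓n≤m _ c) k≤w) w<dr g

Admissible⇒MinOrDescent : ∀ a ρ → Admissible (a ∷ ρ) → MinOrDescent a ρ
Admissible⇒MinOrDescent a []      _       = tt
Admissible⇒MinOrDescent a (b ∷ ρ) (_ , g) = g

Admissible-after-min : ∀ {w γ} a r → Admissible (a ∷ r ++ w ∷ γ) → All (w <_) γ → Linked _>_ γ
Admissible-after-min {w} a r adm w<γ with MinOrDescent-suffix r (Admissible⇒MinOrDescent a (r ++ w ∷ _) adm)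
... | k , g = MinOrDescent-above-decreasing (m⊓n≤n k w) w<γ (MinOrDescent-tail g)

MinOrDescentLastMin-∷ʳ⁺ : ∀ {m x} α → MinOrDescent m α → All (x <_) α → x < m → MinOrDescentLastMin m (α ∷ʳ x)
MinOrDescentLastMin-∷ʳ⁺ []          _       _            x<m = x<m
MinOrDescentLastMin-∷ʳ⁺ (a ∷ [])    _       (x<a ∷ [])   x<m = inj₂ x<a , ⊓-pres-m< x<m x<a
MinOrDescentLastMin-∷ʳ⁺ (a ∷ c ∷ r) (d , g) (x<a ∷ x<cr) x<m =
  d , MinOrDescentLastMin-∷ʳ⁺ (c ∷ r) g x<cr (⊓-pres-m< x<m x<a)

MinOrDescentLastMin-∷ʳ⁻ : ∀ {m x} α → MinOrDescentLastMin m (α ∷ʳ x) → MinOrDescent m α × All (x <_) α × x < m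
MinOrDescentLastMin-∷ʳ⁻ []          x<m     = tt , [] , x<m
MinOrDescentLastMin-∷ʳ⁻ (a ∷ [])    (_ , x<m⊓a) = tt , (m<n⊓o⇒m<o _ a x<m⊓a ∷ []) , m<n⊓o⇒m<n _ a x<m⊓a
MinOrDescentLastMin-∷ʳ⁻ (a ∷ c ∷ r) (d , g) with MinOrDescentLastMin-∷ʳ⁻ (c ∷ r) g
... | g′ , x<cr , x<m⊓a = (d , g′) , (m<n⊓o⇒m<o _ a x<m⊓a ∷ x<cr) , m<n⊓o⇒m<n _ a x<m⊓a

Good-∷ʳ⇔ : ∀ α x → Good (α ∷ʳ x) ⇔ (Admissible α × All (x <_) α)
Good-∷ʳ⇔ α x = mk⇔ (to α) (from α)
  where
  to : ∀ α → Good (α ∷ʳ x) → Admissible α × All (x <_) α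
  to (a ∷ [])    (x<a , _) = tt , (x<a ∷ [])
  to (a ∷ b ∷ r) (b<a , g) with MinOrDescentLastMin-∷ʳ⁻ (b ∷ r) g
  ... | g′ , x<br , x<a = (b<a , g′) , (x<a ∷ x<br)
  from : ∀ α → Admissible α × All (x <_) α → Good (α ∷ʳ x)
  from (a ∷ [])    (_ , (x<a ∷ []))         = x<a , x<a
  from (a ∷ b ∷ r) ((b<a , g) , (x<a ∷ x<br)) = b<a , MinOrDescentLastMin-∷ʳ⁺ (b ∷ r) g x<br x<a


-- Enumerating admissible words

splits : List ℕ → List (List ℕ × List ℕ)
splits []       = ([] , []) ∷ []
splits (x ∷ xs) = map (map₁ (x ∷_)) (splits xs) ++ map (map₂ (x ∷_)) (splits xs)

∈-splits⁻ : ∀ xs {T S} → (T , S) ∈ splits xs → Interleaving T S xs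
∈-splits⁻ []       (here refl) = []
∈-splits⁻ (x ∷ xs) ts∈ with ∈-++⁻ (map (map₁ (x ∷_)) (splits xs)) ts∈
... | inj₁ ts∈ˡ with ∈-map⁻ (map₁ (x ∷_)) ts∈ˡ
...   | _ , ts∈′ , refl = consˡ (∈-splits⁻ xs ts∈′)
∈-splits⁻ (x ∷ xs) ts∈ | inj₂ ts∈ʳ with ∈-map⁻ (map₂ (x ∷_)) ts∈ʳ
...   | _ , ts∈′ , refl = consʳ (∈-splits⁻ xs ts∈′)

∈-splits-filter : ∀ {P : ℕ → Set} (P? : Decidable P) xs → (filter P? xs , filter (¬? ∘ P?) xs) ∈ splits xs
∈-splits-filter P? []       = here refl
∈-splits-filter P? (x ∷ xs) with P? x
... | yes _ = ∈-++⁺ˡ (∈-map⁺ (map₁ (x ∷_)) (∈-splits-filter P? xs))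
... | no  _ = ∈-++⁺ʳ (map (map₁ (x ∷_)) (splits xs)) (∈-map⁺ (map₂ (x ∷_)) (∈-splits-filter P? xs))

∈-splits⇒length≤ : ∀ xs {T S} → (T , S) ∈ splits xs → length S ≤ length xs
∈-splits⇒length≤ xs {T} {S} ts∈ = ≤-trans (length-++-≤ʳ S {T})
    (≤-reflexive (sym (↭-length (toPermutation (∈-splits⁻ xs ts∈)))))

splits-unique : ∀ xs → Unique xs → Unique (map proj₁ (splits xs))
splits-unique []       _          = [] ∷ []
splits-unique (x ∷ xs) (x∉ ∷ u) = subst Unique (sym firsts≡)
  (Unique-++⁺ (Unique-map⁺ ∷-injectiveʳ IH) IH disjoint)
  where
  IH = splits-unique xs u
  firsts≡ : map proj₁ (splits (x ∷ xs)) ≡ map (x ∷_) (map proj₁ (splits xs)) ++ map proj₁ (splits xs)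
  firsts≡ = trans (map-++ proj₁ (map (map₁ (x ∷_)) (splits xs)) (map (map₂ (x ∷_)) (splits xs)))
    (cong₂ _++_ (trans (sym (map-∘ (splits xs))) (map-∘ (splits xs))) (sym (map-∘ (splits xs))))
  disjoint : ∀ {T} → ¬ (T ∈ map (x ∷_) (map proj₁ (splits xs)) × T ∈ map proj₁ (splits xs))
  disjoint (T∈ˡ , T∈) with ∈-map⁻ (x ∷_) T∈ˡ
  ... | _ , _ , refl with ∈-map⁻ proj₁ T∈
  ...   | (_ , S) , ts∈ , refl =
    All-lookup x∉ (∈-resp-↭ (↭-sym (toPermutation (∈-splits⁻ xs ts∈))) (here refl)) refl

-- The first argument is fuel; length W suffices.
mutual
  admissibleWords : ℕ → List ℕ → List (List ℕ)
  admissibleWords zero    _            = []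
  admissibleWords (suc f) []           = []
  admissibleWords (suc f) (w ∷ [])     = [ w ] ∷ []
  admissibleWords (suc f) (w ∷ x ∷ xs) = concatMap (aroundMin f w) (splits (x ∷ xs))

  aroundMin : ℕ → ℕ → List ℕ × List ℕ → List (List ℕ)
  aroundMin f w (T , S) = map (_++ w ∷ reverse T) (admissibleWords f S)

admissibleWords-sound : ∀ f W {α} → AllPairs _<_ W → α ∈ admissibleWords f W → α ↭ W × Admissible α
admissibleWords-sound (suc f) (w ∷ [])     _         (here refl) = ↭-refl , _
admissibleWords-sound (suc f) (w ∷ x ∷ xs) (w< ∷ W↑) α∈ with ∈-concatMap⁻ (aroundMin f w) (splits (x ∷ xs)) α∈
... | (T , S) , ts∈ , α∈′ with ∈-map⁻ (_++ w ∷ reverse T) α∈′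
... | β , β∈ , refl = perm , Admissible-++-min∷decreasing β adm w<β (AllPairs⇒Linked (AllPairs-reverse T↑))
  where
  interleaving : Interleaving T S (x ∷ xs)
  interleaving = ∈-splits⁻ (x ∷ xs) ts∈
  T↑ = proj₁ (Interleaving-AllPairs interleaving W↑)
  βS = proj₁ (admissibleWords-sound f S (proj₂ (Interleaving-AllPairs interleaving W↑)) β∈)
  adm = proj₂ (admissibleWords-sound f S (proj₂ (Interleaving-AllPairs interleaving W↑)) β∈)
  w<β : All (w <_) β
  w<β = All-resp-↭ (↭-sym βS) (++⁻ʳ T (All-resp-↭ (toPermutation interleaving) w<))
  perm : β ++ w ∷ reverse T ↭ w ∷ x ∷ xs
  perm = begin
    β ++ w ∷ reverse T  ↭⟨ shift w β (reverse T) ⟩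
    w ∷ β ++ reverse T  ↭⟨ prep w (++⁺ βS (↭-reverse T)) ⟩
    w ∷ S ++ T          ↭⟨ prep w (++-comm S T) ⟩
    w ∷ T ++ S          ↭⟨ prep w (↭-sym (toPermutation interleaving)) ⟩
    w ∷ x ∷ xs          ∎
    where open PermutationReasoning

admissibleWords-complete : ∀ f W {α} → AllPairs _<_ W → length W ≤ f → α ↭ W → Admissible α → α ∈ admissibleWords f W
admissibleWords-complete f (w ∷ x ∷ xs) W↑ short p adm with ∈-∃++ (∈-resp-↭ (↭-sym p) (here refl))
admissibleWords-complete (suc f) (w ∷ x ∷ xs) (w< ∷ W↑) (s≤s short) p adm | a ∷ r , γ , refl =
  ∈-concatMap⁺ (aroundMin f w) (∈-splits-filter (_∈? γ) (x ∷ xs))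
    (subst (λ γ′ → a ∷ r ++ w ∷ γ′ ∈ aroundMin f w (T , S)) reverse-T≡γ (∈-map⁺ (_++ w ∷ reverse T) β∈))
  where
  β = a ∷ r
  T = filter (_∈? γ) (x ∷ xs)
  S = filter (¬? ∘ (_∈? γ)) (x ∷ xs)
  interleaving : Interleaving T S (x ∷ xs)
  interleaving = ∈-splits⁻ (x ∷ xs) (∈-splits-filter (_∈? γ) (x ∷ xs))
  βγ↭ : β ++ γ ↭ x ∷ xs
  βγ↭ = drop-∷ (↭-trans (↭-sym (shift w β γ)) p)
  w∉γ : w ∉ γ
  w∉γ = Unique[x∷xs]⇒x∉xs (proj₂ (Unique-++⁻ β (Unique-resp-↭ (↭-sym p) (increasing⇒unique (w< ∷ W↑)))))
  γ⊆ : ∀ {y} → y ∈ γ → y ∈ x ∷ xs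
  γ⊆ y∈ with ∈-resp-↭ p (∈-++⁺ʳ β (there y∈))
  ... | here refl = contradiction y∈ w∉γ
  ... | there y∈′ = y∈′
  γ↓ : Linked _>_ γ
  γ↓ = Admissible-after-min a r adm (All-tabulate (All-lookup w< ∘ γ⊆))
  T≡ : T ≡ reverse γ
  T≡ = filter-∈-decreasing W↑ γ↓ γ⊆
  reverse-T≡γ : reverse T ≡ γ
  reverse-T≡γ = trans (cong reverse T≡) (reverse-involutive γ)
  βS : β ↭ S
  βS = ++-cancelˡ-↭ γ (begin
    γ ++ β          ↭⟨ ++-comm γ β ⟩
    β ++ γ          ↭⟨ βγ↭ ⟩
    x ∷ xs          ↭⟨ toPermutation interleaving ⟩
    T ++ S          ≡⟨ cong (_++ S) T≡ ⟩
    reverse γ ++ S  ↭⟨ ++⁺ (↭-reverse γ) ↭-refl ⟩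
    γ ++ S          ∎)
    where open PermutationReasoning
  β∈ : β ∈ admissibleWords f S
  β∈ = admissibleWords-complete f S (proj₂ (Interleaving-AllPairs interleaving W↑))
         (≤-trans (∈-splits⇒length≤ (x ∷ xs) (∈-splits-filter (_∈? γ) (x ∷ xs))) short)
         βS (Admissible-prefix a r adm)
admissibleWords-complete f (w ∷ x ∷ xs) W↑ short p adm | [] , [] , refl with ↭-length p
... | ()
admissibleWords-complete f (w ∷ x ∷ xs) (w< ∷ _) short p (c<w , _) | [] , c ∷ γ , refl
  with ∈-resp-↭ p (there (here refl))
... | here refl = contradiction c<w (<-irrefl refl)
... | there c∈  = contradiction (All-lookup w< c∈) (<-asym c<w)
admissibleWords-complete f [] _ _ p adm with ↭-empty-inv p
admissibleWords-complete f [] _ _ p () | refl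
admissibleWords-complete (suc f) (w ∷ []) _ _ p _ with ↭-singleton-inv p
... | refl = here refl

admissibleWords-unique : ∀ f W → AllPairs _<_ W → Unique (admissibleWords f W)
admissibleWords-unique zero    _            _         = []
admissibleWords-unique (suc f) []           _         = []
admissibleWords-unique (suc f) (w ∷ [])     _         = [] ∷ []
admissibleWords-unique (suc f) (w ∷ x ∷ xs) (w< ∷ W↑) =
  Unique-concatMap (aroundMin f w) proj₁ (splits (x ∷ xs))
      (splits-unique (x ∷ xs) (increasing⇒unique W↑)) unique-around same-T
  where
  S↑ : ∀ {T S} → (T , S) ∈ splits (x ∷ xs) → AllPairs _<_ S
  S↑ ts∈ = proj₂ (Interleaving-AllPairs (∈-splits⁻ (x ∷ xs) ts∈) W↑)
  unique-around : ∀ {ts} → ts ∈ splits (x ∷ xs) → Unique (aroundMin f w ts)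
  unique-around {T , S} ts∈ = Unique-map⁺ (++-cancelʳ (w ∷ reverse T) _ _) (admissibleWords-unique f S (S↑ ts∈))
  w∉ : ∀ {T S β} → (T , S) ∈ splits (x ∷ xs) → β ∈ admissibleWords f S → w ∉ β
  w∉ {T} {S} ts∈ β∈ w∈β = <-irrefl refl (All-lookup w<S (∈-resp-↭ (proj₁ (admissibleWords-sound f S (S↑ ts∈) β∈)) w∈β))
    where
    w<S : All (w <_) S
    w<S = ++⁻ʳ T (All-resp-↭ (toPermutation (∈-splits⁻ (x ∷ xs) ts∈)) w<)
  same-T : ∀ {ts ts′ v} → ts ∈ splits (x ∷ xs) → ts′ ∈ splits (x ∷ xs) → v ∈ aroundMin f w ts →
      v ∈ aroundMin f w ts′ → proj₁ ts ≡ proj₁ ts′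
  same-T {T , S} {T′ , S′} ts∈ ts′∈ v∈ v∈′ with ∈-map⁻ (_++ w ∷ reverse T) v∈ | ∈-map⁻ (_++ w ∷ reverse T′) v∈′
  ... | β , β∈ , refl | β′ , β′∈ , eq =
    reverse-injective (proj₂ (++-∷-injective β β′ (w∉ ts∈ β∈) (w∉ ts′∈ β′∈) eq))


-- Counting

sumUpTo : ℕ → (ℕ → ℕ) → ℕ
sumUpTo zero    g = g 0
sumUpTo (suc K) g = g 0 + sumUpTo K (g ∘ suc)

sumUpTo-cong : ∀ K {f g} → (∀ s → f s ≡ g s) → sumUpTo K f ≡ sumUpTo K g
sumUpTo-cong zero    f≗g = f≗g 0
sumUpTo-cong (suc K) f≗g = cong₂ _+_ (f≗g 0) (sumUpTo-cong K (f≗g ∘ suc))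

sumUpTo-+ : ∀ K f g → sumUpTo K (λ s → f s + g s) ≡ sumUpTo K f + sumUpTo K g
sumUpTo-+ zero    f g = refl
sumUpTo-+ (suc K) f g = trans (cong (f 0 + g 0 +_) (sumUpTo-+ K (f ∘ suc) (g ∘ suc)))
  (interchange +-commutativeSemigroup (f 0) (g 0) (sumUpTo K (f ∘ suc)) (sumUpTo K (g ∘ suc)))

sumUpTo-last-0 : ∀ K g → g (suc K) ≡ 0 → sumUpTo (suc K) g ≡ sumUpTo K g
sumUpTo-last-0 zero    g last≡0 = trans (cong (g 0 +_) last≡0) (+-identityʳ (g 0))
sumUpTo-last-0 (suc K) g last≡0 = cong (g 0 +_) (sumUpTo-last-0 K (g ∘ suc) last≡0)

sum-applyUpTo : ∀ (φ g : ℕ → ℕ) K → sum (map φ (applyUpTo g (suc K))) ≡ sumUpTo K (φ ∘ g)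
sum-applyUpTo φ g zero    = +-identityʳ _
sum-applyUpTo φ g (suc K) = cong (φ (g 0) +_) (sum-applyUpTo φ (g ∘ suc) K)

binomialSum : ℕ → (ℕ → ℕ) → ℕ
binomialSum K h = sumUpTo K (λ s → (K C s) * h s)

binomialSum-pascal : ∀ K h → binomialSum K h + binomialSum K (h ∘ suc) ≡ binomialSum (suc K) h
binomialSum-pascal K h = begin
  binomialSum K h + binomialSum K (h ∘ suc)
    ≡⟨ cong (_+ binomialSum K (h ∘ suc)) (binomialSum-head K) ⟩
  h 0 + S₁ + S₂
    ≡⟨ +-assoc (h 0) S₁ S₂ ⟩
  h 0 + (S₁ + S₂)
    ≡⟨ cong (h 0 +_) (trans (+-comm S₁ S₂) (sym (sumUpTo-+ K _ _))) ⟩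
  h 0 + sumUpTo K (λ s → (K C s) * h (suc s) + (K C suc s) * h (suc s))
    ≡⟨ cong₂ _+_ (sym (+-identityʳ (h 0))) (sumUpTo-cong K pascal) ⟩
  binomialSum (suc K) h ∎
  where
  open ≡-Reasoning
  S₁ = sumUpTo K (λ s → (K C suc s) * h (suc s))
  S₂ = binomialSum K (h ∘ suc)
  binomialSum-head : ∀ K → binomialSum K h ≡ h 0 + sumUpTo K (λ s → (K C suc s) * h (suc s))
  binomialSum-head zero    = trans (+-identityʳ (h 0)) (sym (+-identityʳ (h 0)))
  binomialSum-head (suc K) = cong₂ _+_ (+-identityʳ (h 0))
    (sym (sumUpTo-last-0 K (λ s → (suc K C suc s) * h (suc s)) (cong (_* h (suc (suc K))) (k>n⇒nCk≡0 (n<1+n (suc K))))))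
  pascal : ∀ s → (K C s) * h (suc s) + (K C suc s) * h (suc s) ≡ (suc K C suc s) * h (suc s)
  pascal s = trans (sym (*-distribʳ-+ (h (suc s)) (K C s) (K C suc s)))
      (cong (_* h (suc s)) (nCk+nC[k+1]≡[n+1]C[k+1] K s))

splits-binomialSum : ∀ (h : ℕ → ℕ) xs → sum (map (h ∘ length ∘ proj₂) (splits xs)) ≡ binomialSum (length xs) h
splits-binomialSum h []       = trans (+-identityʳ (h 0)) (sym (+-identityʳ (h 0)))
splits-binomialSum h (x ∷ xs) = begin
  sum (map φ (map (map₁ (x ∷_)) (splits xs) ++ map (map₂ (x ∷_)) (splits xs)))
    ≡⟨ cong sum (map-++ φ (map (map₁ (x ∷_)) (splits xs)) _) ⟩
  sum (map φ (map (map₁ (x ∷_)) (splits xs)) ++ map φ (map (map₂ (x ∷_)) (splits xs)))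
    ≡⟨ sum-++ (map φ (map (map₁ (x ∷_)) (splits xs))) _ ⟩
  sum (map φ (map (map₁ (x ∷_)) (splits xs))) + sum (map φ (map (map₂ (x ∷_)) (splits xs)))
    ≡⟨ cong₂ (λ l l′ → sum l + sum l′) (sym (map-∘ (splits xs))) (sym (map-∘ (splits xs))) ⟩
  sum (map φ (splits xs)) + sum (map (h ∘ suc ∘ length ∘ proj₂) (splits xs))
    ≡⟨ cong₂ _+_ (splits-binomialSum h xs) (splits-binomialSum (h ∘ suc) xs) ⟩
  binomialSum (length xs) h + binomialSum (length xs) (h ∘ suc)
    ≡⟨ binomialSum-pascal (length xs) h ⟩
  binomialSum (suc (length xs)) h ∎
  where
  open ≡-Reasoning
  φ = h ∘ length ∘ proj₂

length-admissibleWords : ∀ (h : ℕ → ℕ) → h 0 ≡ 0 → h 1 ≡ 1 →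
    (∀ m → h (suc (suc m)) ≡ binomialSum (suc m) h) →
    ∀ f W → length W ≤ f → length (admissibleWords f W) ≡ h (length W)
length-admissibleWords h h₀ h₁ h-rec = count
  where
  count : ∀ f W → length W ≤ f → length (admissibleWords f W) ≡ h (length W)
  count zero    []           _           = sym h₀
  count (suc f) []           _           = sym h₀
  count (suc f) (w ∷ [])     _           = sym h₁
  count (suc f) (w ∷ x ∷ xs) (s≤s short) = begin
    length (concatMap (aroundMin f w) (splits (x ∷ xs)))  ≡⟨ length-concatMap (aroundMin f w) (splits (x ∷ xs)) ⟩
    sum (map (length ∘ aroundMin f w) (splits (x ∷ xs)))  ≡⟨ cong sum (map-cong-local (All-tabulate count-around)) ⟩
    sum (map (h ∘ length ∘ proj₂) (splits (x ∷ xs)))      ≡⟨ splits-binomialSum h (x ∷ xs) ⟩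
    binomialSum (suc (length xs)) h                        ≡⟨ sym (h-rec (length xs)) ⟩
    h (suc (suc (length xs)))                              ∎
    where
    open ≡-Reasoning
    count-around : ∀ {ts} → ts ∈ splits (x ∷ xs) → length (aroundMin f w ts) ≡ h (length (proj₂ ts))
    count-around {T , S} ts∈ = trans (length-map _ (admissibleWords f S))
        (count f S (≤-trans (∈-splits⇒length≤ (x ∷ xs) ts∈) short))


-- The avoiders in S_n

[2‥_] : ℕ → List ℕ
[2‥ m ] = applyUpTo (suc ∘ suc) m

[2‥]-increasing : ∀ m → AllPairs _<_ [2‥ m ]
[2‥]-increasing m = AllPairsₚ.applyUpTo⁺₁ (suc ∘ suc) m (λ i<j _ → s≤s (s≤s i<j))

good-permutations : ∀ m π → π ∈ map (_∷ʳ 1) (admissibleWords m [2‥ m ]) ⇔ (IsPerm (suc m) π × Good π)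
good-permutations m π = mk⇔ to from
  where
  W↑ = [2‥]-increasing m
  1<W : All (1 <_) [2‥ m ]
  1<W = All-tabulate λ y∈ → let _ , _ , y≡ = ∈-applyUpTo⁻ (suc ∘ suc) y∈ in subst (1 <_) (sym y≡) (s≤s (s≤s z≤n))
  to : π ∈ map (_∷ʳ 1) (admissibleWords m [2‥ m ]) → IsPerm (suc m) π × Good π
  to π∈ with ∈-map⁻ (_∷ʳ 1) π∈
  ... | α , α∈ , refl with admissibleWords-sound m [2‥ m ] W↑ α∈
  ...   | αW , adm = ↭-trans (↭-sym (∷↭∷ʳ 1 α)) (prep 1 αW) ,
                     Equivalence.from (Good-∷ʳ⇔ α 1) (adm , All-resp-↭ (↭-sym αW) 1<W)
  from : IsPerm (suc m) π × Good π → π ∈ map (_∷ʳ 1) (admissibleWords m [2‥ m ])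
  from (perm , good) with initLast π
  from (perm , ()) | []
  from (perm , good) | α ∷ʳ′ x with Equivalence.to (Good-∷ʳ⇔ α x) good
  ... | adm , x<α with ∈-++⁻ α (∈-resp-↭ (↭-sym perm) (here refl))
  ...   | inj₁ 1∈α = contradiction (≤-<-trans 1≤x (All-lookup x<α 1∈α)) (<-irrefl refl)
    where
    1≤x : 1 ≤ x
    1≤x = proj₁ (∈-[1‥]⁻ (suc m) (∈-resp-↭ perm (∈-++⁺ʳ α (here refl))))
  ...   | inj₂ (here refl) =
    ∈-map⁺ (_∷ʳ 1) (admissibleWords-complete m [2‥ m ] W↑ (≤-reflexive (length-applyUpTo _ m))
      (drop-∷ (↭-trans (∷↭∷ʳ 1 α) perm)) adm)

theorem6p6 : (G : ℕ → ℕ) → G 0 ≡ 1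
           → (∀ m → G (suc m) ≡ sum (map (λ k → (suc m C k) * G (k ∸ 1)) (applyUpTo suc (suc m))))
           → (n : ℕ) → 2 ≤ n
           → Σ (List (List ℕ)) λ L → Unique L
               × (∀ π → π ∈ L ⇔ (IsPerm n π × Avoids n π pat-12-2→3 × Avoids n π pat-1-1→1))
               × length L ≡ G (n ∸ 2)
theorem6p6 G G₀ G-rec n@(suc (suc k)) 2≤n@(s≤s (s≤s z≤n)) = L , unique , membership , count
  where
  W = [2‥ suc k ]
  L = map (_∷ʳ 1) (admissibleWords (suc k) W)

  unique : Unique L
  unique = Unique-map⁺ (∷ʳ-injectiveˡ _ _) (admissibleWords-unique (suc k) W ([2‥]-increasing (suc k)))

  membership : ∀ π → π ∈ L ⇔ (IsPerm n π × Avoids n π pat-12-2→3 × Avoids n π pat-1-1→1)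
  membership π = ⇔.trans (good-permutations (suc k) π)
    (mk⇔ (λ (perm , good)   → perm , Equivalence.from (avoiders⇔good perm 2≤n) good)
         (λ (perm , avoids) → perm , Equivalence.to (avoiders⇔good perm 2≤n) avoids))

  h : ℕ → ℕ
  h zero    = 0
  h (suc m) = G m

  h-rec : ∀ m → h (suc (suc m)) ≡ binomialSum (suc m) h
  h-rec m = trans (G-rec m) (sum-applyUpTo (λ k → (suc m C k) * G (k ∸ 1)) suc m)

  count : length L ≡ G k
  count = begin
    length L                          ≡⟨ length-map _ (admissibleWords (suc k) W) ⟩
    length (admissibleWords (suc k) W) ≡⟨ length-admissibleWords h refl G₀ h-rec (suc k) W (≤-reflexive length-W) ⟩
    h (length W)                      ≡⟨ cong h length-W ⟩
    G k                               ∎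
    where
    open ≡-Reasoning
    length-W : length W ≡ suc k
    length-W = length-applyUpTo (suc ∘ suc) (suc k)
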